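{- Let $R$ be a finite unital ring, let $\mathrm{Rad}(R)$ be its Jacobson radical and $R^{ss}=R/\mathrm{Rad}(R)$. Write (by Artin–Wedderburn) \[R^{ss}\cong\prod_{i=1}^sR_i\times\prod_{i=1}^rM_{d_i}(F_i),\] with $R_i,F_i$ finite fields and $d_i\ge2$. Let $G_R=\Gamma(R,R^\times)$ be the unitary Cayley graph of $R$. Then $G_R$ (equivalently $G_{R^{ss}}$) is connected if and only if there is at most one $i\in\{1,\dots,s\}$ with $|R_i|=2$.
   Context: The Cayley graph $\Gamma(R,S)$ has vertex set $R$, with $a,b$ adjacent iff $a-b\in S$. The unitary Cayley graph $G_R$ is $\Gamma(R,R^\times)$, where $R^\times$ is the unit group. -}

module Defs where

open import Level using (0ℓ)
open import Data.Nat using (ℕ; zero; suc; _≤_)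
open import Data.Fin using (Fin; zero; suc; _≟_)
open import Data.Bool using (if_then_else_)
open import Data.Product using (Σ; ∃-syntax; _×_; _,_)
open import Relation.Nullary using (¬_; does)
open import Relation.Binary.PropositionalEquality using (_≡_)
open import Relation.Binary.Construct.Closure.ReflexiveTransitive using (Star)
open import Function using (_∘_)
open import Algebra.Bundles using (Ring; CommutativeRing)

record IsFiniteSetoid {A : Set} (_≈_ : A → A → Set) : Set where
  field
    size       : ℕ
    toFin      : A → Fin size
    fromFin    : Fin size → A
    toFin-cong : ∀ {x y} → x ≈ y → toFin x ≡ toFin y
    from-to    : ∀ x → fromFin (toFin x) ≈ x
    to-from    : ∀ i → toFin (fromFin i) ≡ i

FiniteRing : Ring 0ℓ 0ℓ → Set
FiniteRing R = IsFiniteSetoid (Ring._≈_ R)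

record FiniteField : Set₁ where
  field
    commRing : CommutativeRing 0ℓ 0ℓ
  open CommutativeRing commRing using (Carrier; _≈_; _*_; 0#; 1#)
  field
    nontrivial : ¬ (1# ≈ 0#)
    inverse    : ∀ x → ¬ (x ≈ 0#) → ∃[ y ] (x * y ≈ 1#)
    finite     : IsFiniteSetoid _≈_

card : FiniteField → ℕ
card F = IsFiniteSetoid.size (FiniteField.finite F)

module MatrixOps (F : FiniteField) where
  open CommutativeRing (FiniteField.commRing F)
    using (Carrier; _≈_; _+_; _*_; 0#; 1#)

  Mat : ℕ → Set
  Mat d = Fin d → Fin d → Carrier

  sumFin : ∀ n → (Fin n → Carrier) → Carrier
  sumFin zero    f = 0#
  sumFin (suc n) f = f zero + sumFin n (f ∘ suc)

  _≈M_ : ∀ {d} → Mat d → Mat d → Set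
  A ≈M B = ∀ i j → A i j ≈ B i j

  _+M_ : ∀ {d} → Mat d → Mat d → Mat d
  (A +M B) i j = A i j + B i j

  _*M_ : ∀ {d} → Mat d → Mat d → Mat d
  _*M_ {d} A B i k = sumFin d (λ j → A i j * B j k)

  1M : ∀ {d} → Mat d
  1M i j = if does (i ≟ j) then 1# else 0#

module RingDefs (R : Ring 0ℓ 0ℓ) where
  open Ring R using (Carrier; _≈_; _+_; _*_; -_; 0#; 1#)

  record IsLeftIdeal (I : Carrier → Set) : Set where
    field
      resp       : ∀ {x y} → x ≈ y → I x → I y
      zero∈      : I 0#
      +-closed   : ∀ {x y} → I x → I y → I (x + y)
      neg-closed : ∀ {x} → I x → I (- x)
      *-closed   : ∀ r {x} → I x → I (r * x)

  record IsMaximalLeftIdeal (I : Carrier → Set) : Set₁ where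
    field
      isLeftIdeal : IsLeftIdeal I
      proper      : ¬ I 1#
      maximal     : ∀ (J : Carrier → Set) → IsLeftIdeal J →
                    (∀ {x} → I x → J x) → ¬ J 1# → ∀ {x} → J x → I x

  Rad : Carrier → Set₁
  Rad x = ∀ (I : Carrier → Set) → IsMaximalLeftIdeal I → I x

  IsUnit : Carrier → Set
  IsUnit x = ∃[ u ] (x * u ≈ 1# × u * x ≈ 1#)

  Adj : Carrier → Carrier → Set
  Adj a b = IsUnit (a + - b)

  -- connectedness (vertices are elements of R up to ≈)
  Connected : Set
  Connected = ∀ a b → ∃[ c ] (Star Adj a c × c ≈ b)

  -- An Artin–Wedderburn decomposition
  --   R/Rad(R) ≅ ∏_{i<s} R_i × ∏_{i<r} M_{d_i}(F_i),
  -- R_i, F_i finite fields, d_i ≥ 2.  The quotient R/Rad(R) is given by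
  -- the carrier of R with x ≡ y iff x - y ∈ Rad(R); φ is a map from R
  -- inducing a ring isomorphism of R/Rad(R) onto the product.
  record ArtinWedderburn : Set₁ where
    field
      s  : ℕ
      Rs : Fin s → FiniteField
      r  : ℕ
      d  : Fin r → ℕ
      d≥2 : ∀ i → 2 ≤ d i
      Fs : Fin r → FiniteField

    P : Set
    P = ((i : Fin s) → CommutativeRing.Carrier (FiniteField.commRing (Rs i)))
      × ((i : Fin r) → MatrixOps.Mat (Fs i) (d i))

    _≈P_ : P → P → Set
    (x , X) ≈P (y , Y) =
      (∀ i → CommutativeRing._≈_ (FiniteField.commRing (Rs i)) (x i) (y i))
      × (∀ i → MatrixOps._≈M_ (Fs i) (X i) (Y i))

    _+P_ : P → P → P
    (x , X) +P (y , Y) =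
      (λ i → CommutativeRing._+_ (FiniteField.commRing (Rs i)) (x i) (y i))
      , (λ i → MatrixOps._+M_ (Fs i) (X i) (Y i))

    _*P_ : P → P → P
    (x , X) *P (y , Y) =
      (λ i → CommutativeRing._*_ (FiniteField.commRing (Rs i)) (x i) (y i))
      , (λ i → MatrixOps._*M_ (Fs i) (X i) (Y i))

    1P : P
    1P = (λ i → CommutativeRing.1# (FiniteField.commRing (Rs i)))
       , (λ i → MatrixOps.1M (Fs i))

    field
      φ        : Carrier → P
      φ-cong   : ∀ {x y} → Rad (x + - y) → φ x ≈P φ y
      φ-inj    : ∀ {x y} → φ x ≈P φ y → Rad (x + - y)
      φ-surj   : ∀ p → ∃[ x ] (φ x ≈P p)
      φ-+      : ∀ x y → φ (x + y) ≈P (φ x +P φ y)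
      φ-*      : ∀ x y → φ (x * y) ≈P (φ x *P φ y)
      φ-1      : φ 1# ≈P 1P

    AtMostOneF₂ : Set
    AtMostOneF₂ = ∀ i j → card (Rs i) ≡ 2 → card (Rs j) ≡ 2 → i ≡ j

-- Let φ : R → ∏ Rᵢ × ∏ M_{dᵢ}(Fᵢ) be the reduction modulo Rad(R).
--
-- If Rᵢ and Rⱼ (i ≠ j) both have two elements, then along an edge x ∼ y the element φ(x − y)
-- is a unit, so the i-th and j-th coordinates of φ both switch between 0 and 1. Hence the xor
-- of "the i-th coordinate is 0" and "the j-th coordinate is 0" is constant on connected
-- components, yet it differs at 0 and at a preimage of the i-th unit vector.
--
-- Conversely, G_R is connected once every element is a sum of units, since adding a unit is an
-- edge. The sums of units form a subring S of R containing Rad(R), because 1 + z is a unit for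
-- z in the radical (finiteness lets every proper left ideal grow to a maximal one). Units of
-- the product lift to units of R, as φ(x) = 1 means x ∈ 1 + Rad(R), so φ(S) is a subring of
-- the product containing all its units. With at most one 𝔽₂ factor such a subring is
-- everything: in a field with more than two elements a = (a + y) − y with a + y and y nonzero;
-- in M_d(F) with d ≥ 2 the off-diagonal E_pq(a) = (1 + E_pq(a)) − 1 generate all matrices as a
-- ring; and the single 𝔽₂ coordinate is matched by subtracting 0 or 1.

{-# OPTIONS --safe #-}
module Submission where

open import Defs
open import Level using (0ℓ)
open import Algebra.Bundles using (Ring; CommutativeRing)
import Algebra.Properties.Ring as RingProperties
import Algebra.Properties.CommutativeSemigroup as CommutativeSemigroupProperties
import Relation.Binary.Reasoning.Setoid as SetoidReasoning
open import Function using (_⇔_; mk⇔; _∘_)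
open import Data.Nat using (zero; suc; _≤_; s≤s; z≤n) renaming (_≟_ to _≟ⁿ_)
open import Data.Fin using (Fin; zero; suc)
open import Data.Fin.Properties using (any?; suc-injective) renaming (_≟_ to _≟ᶠ_)
open import Data.Product using (Σ-syntax; ∃; ∃-syntax; _×_; _,_; proj₁; proj₂)
open import Data.Sum using (_⊎_; inj₁; inj₂)
open import Data.Empty using (⊥-elim)
open import Data.Bool using (Bool; true; false; not; _xor_)
open import Data.Bool.Properties using (not-involutive)
open import Relation.Nullary using (¬_; Dec; yes; no; does)
open import Relation.Binary.Structures using (IsEquivalence)
open import Relation.Binary.PropositionalEquality as ≡ using (_≡_; refl; _≢_)
open import Relation.Binary.Construct.Closure.ReflexiveTransitive using (Star; ε; _◅_; _◅◅_)

updateAt : ∀ {n} {C : Fin n → Set} → (∀ j → C j) → (c : Fin n) → C c → ∀ j → C j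
updateAt f zero    a zero    = a
updateAt f zero    a (suc j) = f (suc j)
updateAt f (suc c) a zero    = f zero
updateAt {C = C} f (suc c) a (suc j) = updateAt {C = C ∘ suc} (f ∘ suc) c a j

updateAt-updates : ∀ {n} {C : Fin n → Set} (f : ∀ j → C j) c a → updateAt f c a c ≡ a
updateAt-updates f zero    a = refl
updateAt-updates {C = C} f (suc c) a = updateAt-updates {C = C ∘ suc} (f ∘ suc) c a

updateAt-minimal : ∀ {n} {C : Fin n → Set} (f : ∀ j → C j) c a j → c ≢ j → updateAt f c a j ≡ f j
updateAt-minimal f zero    a zero    c≢j = ⊥-elim (c≢j refl)
updateAt-minimal f zero    a (suc j) c≢j = refl
updateAt-minimal f (suc c) a zero    c≢j = refl
updateAt-minimal {C = C} f (suc c) a (suc j) c≢j =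
  updateAt-minimal {C = C ∘ suc} (f ∘ suc) c a j (c≢j ∘ ≡.cong suc)

updateAt-elim : ∀ {n} {C : Fin n → Set} (Q : ∀ j → C j → Set) (f : ∀ j → C j) c a j →
                Q c a → (c ≢ j → Q j (f j)) → Q j (updateAt f c a j)
updateAt-elim Q f c a j qa qf with c ≟ᶠ j
... | yes refl rewrite updateAt-updates f c a = qa
... | no c≢j rewrite updateAt-minimal f c a j c≢j = qf c≢j

updateAt-elim₂ : ∀ {n} {C : Fin n → Set} (Q : ∀ j → C j → C j → Set) (f g : ∀ j → C j) c a b j →
                 Q c a b → (c ≢ j → Q j (f j) (g j)) →
                 Q j (updateAt f c a j) (updateAt g c b j)
updateAt-elim₂ Q f g c a b j qab qfg with c ≟ᶠ j
... | yes refl rewrite updateAt-updates f c a | updateAt-updates g c b = qab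
... | no c≢j rewrite updateAt-minimal f c a j c≢j | updateAt-minimal g c b j c≢j = qfg c≢j

updateAt-elim₃ : ∀ {n} {C : Fin n → Set} (Q : ∀ j → C j → C j → C j → Set) (f g h : ∀ j → C j) →
                 ∀ c a b e j →
                 Q c a b e → (c ≢ j → Q j (f j) (g j) (h j)) →
                 Q j (updateAt f c a j) (updateAt g c b j) (updateAt h c e j)
updateAt-elim₃ Q f g h c a b e j qabe qfgh with c ≟ᶠ j
... | yes refl rewrite updateAt-updates f c a | updateAt-updates g c b | updateAt-updates h c e = qabe
... | no c≢j rewrite updateAt-minimal f c a j c≢j | updateAt-minimal g c b j c≢j
                   | updateAt-minimal h c e j c≢j = qfgh c≢j

∃-distinct : ∀ {n} → 2 ≤ n → (p : Fin n) → ∃[ q ] p ≢ q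
∃-distinct (s≤s (s≤s z≤n)) zero    = suc zero , λ ()
∃-distinct (s≤s (s≤s z≤n)) (suc p) = zero , λ ()

Fin2-covered : (a b c : Fin 2) → a ≢ b → c ≡ a ⊎ c ≡ b
Fin2-covered zero       zero       c          a≢b = ⊥-elim (a≢b refl)
Fin2-covered (suc zero) (suc zero) c          a≢b = ⊥-elim (a≢b refl)
Fin2-covered zero       (suc zero) zero       a≢b = inj₁ refl
Fin2-covered zero       (suc zero) (suc zero) a≢b = inj₂ refl
Fin2-covered (suc zero) zero       zero       a≢b = inj₂ refl
Fin2-covered (suc zero) zero       (suc zero) a≢b = inj₁ refl

∃-distinct-from-zero : ∀ {m} (b : Fin (suc (suc (suc m)))) → ∃[ c ] (c ≢ zero × c ≢ b)
∃-distinct-from-zero b with b ≟ᶠ suc zero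
... | yes refl = suc (suc zero) , (λ ()) , (λ ())
... | no b≢1   = suc zero , (λ ()) , b≢1 ∘ ≡.sym

∃-distinct₂ : ∀ {n} → n ≢ 2 → (a b : Fin n) → a ≢ b → ∃[ c ] (c ≢ a × c ≢ b)
∃-distinct₂ {1}                 n≢2 zero zero a≢b = ⊥-elim (a≢b refl)
∃-distinct₂ {2}                 n≢2 a    b    a≢b = ⊥-elim (n≢2 refl)
∃-distinct₂ {suc (suc (suc m))} n≢2 a    b    a≢b with zero ≟ᶠ a | zero ≟ᶠ b
... | no 0≢a   | no 0≢b   = zero , 0≢a , 0≢b
... | yes refl | _        = ∃-distinct-from-zero b
... | no _     | yes refl = let c , c≢0 , c≢a = ∃-distinct-from-zero a in c , c≢a , c≢0

not-xor-not : ∀ a b → not a xor not b ≡ a xor b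
not-xor-not true  b = refl
not-xor-not false b = not-involutive b

module FiniteSetoidProperties {A : Set} {_≈_ : A → A → Set}
  (isEquivalence : IsEquivalence _≈_) (finite : IsFiniteSetoid _≈_) where
  open IsEquivalence isEquivalence
  open IsFiniteSetoid finite

  toFin-injective : ∀ {x y} → toFin x ≡ toFin y → x ≈ y
  toFin-injective {x} {y} eq = trans (sym (from-to x)) (trans (reflexive (≡.cong fromFin eq)) (from-to y))

  infix 4 _≟_
  _≟_ : ∀ x y → Dec (x ≈ y)
  x ≟ y with toFin x ≟ᶠ toFin y
  ... | yes eq = yes (toFin-injective eq)
  ... | no neq = no (neq ∘ toFin-cong)

  ∃? : (Q : A → Set) → (∀ {a b} → a ≈ b → Q a → Q b) → (∀ a → Dec (Q a)) → Dec (∃ Q)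
  ∃? Q resp Q? with any? (Q? ∘ fromFin)
  ... | yes (i , q) = yes (fromFin i , q)
  ... | no ¬q       = no λ (a , qa) → ¬q (toFin a , resp (sym (from-to a)) qa)

  size≡2⇒≈⊎≈ : size ≡ 2 → ∀ {x y} → ¬ x ≈ y → ∀ z → z ≈ x ⊎ z ≈ y
  size≡2⇒≈⊎≈ refl x≉y z with Fin2-covered _ _ (toFin z) (x≉y ∘ toFin-injective)
  ... | inj₁ eq = inj₁ (toFin-injective eq)
  ... | inj₂ eq = inj₂ (toFin-injective eq)

  size≢2⇒∃≉ : size ≢ 2 → ∀ {x y} → ¬ x ≈ y → ∃[ z ] (¬ z ≈ x × ¬ z ≈ y)
  size≢2⇒∃≉ size≢2 x≉y with ∃-distinct₂ size≢2 _ _ (x≉y ∘ toFin-injective)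
  ... | i , i≢x , i≢y = fromFin i , i≢x ∘ fromFin≈ , i≢y ∘ fromFin≈
    where
    fromFin≈ : ∀ {i z} → fromFin i ≈ z → i ≡ toFin z
    fromFin≈ {i} eq = ≡.trans (≡.sym (to-from i)) (toFin-cong eq)

module FiniteFieldProperties (F : FiniteField) where
  open FiniteField F using (nontrivial; finite)
  open CommutativeRing (FiniteField.commRing F) hiding (zero; refl)
  open RingProperties ring using (x≈y⇒x∙y⁻¹≈ε; +-cancelˡ)
  open FiniteSetoidProperties isEquivalence finite using (_≟_; size≡2⇒≈⊎≈; size≢2⇒∃≉)

  card≡2⇒≈0⊎≈1 : card F ≡ 2 → ∀ x → x ≈ 0# ⊎ x ≈ 1#
  card≡2⇒≈0⊎≈1 card≡2 = size≡2⇒≈⊎≈ card≡2 (nontrivial ∘ sym)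

  card≢2⇒nonzero-translate : card F ≢ 2 → ∀ a → ∃[ y ] (¬ y ≈ 0# × ¬ a + y ≈ 0#)
  card≢2⇒nonzero-translate card≢2 a with a + 1# ≟ 0#
  ... | no a+1≉0 = 1# , nontrivial , a+1≉0
  ... | yes a+1≈0 =
    let g , g≉0 , g≉1 = size≢2⇒∃≉ card≢2 (nontrivial ∘ sym)
    in  g , g≉0 , λ a+g≈0 → g≉1 (+-cancelˡ a g 1# (trans a+g≈0 (sym a+1≈0)))

  isZero : Carrier → Bool
  isZero a = does (a ≟ 0#)

  isZero-cong : ∀ {a b} → a ≈ b → isZero a ≡ isZero b
  isZero-cong {a} {b} a≈b with a ≟ 0# | b ≟ 0#
  ... | yes _   | yes _   = refl
  ... | no _    | no _    = refl
  ... | yes a≈0 | no b≉0  = ⊥-elim (b≉0 (trans (sym a≈b) a≈0))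
  ... | no a≉0  | yes b≈0 = ⊥-elim (a≉0 (trans a≈b b≈0))

  isZero-≈0 : ∀ {a} → a ≈ 0# → isZero a ≡ true
  isZero-≈0 {a} a≈0 with a ≟ 0#
  ... | yes _   = refl
  ... | no a≉0  = ⊥-elim (a≉0 a≈0)

  isZero-≉0 : ∀ {a} → ¬ a ≈ 0# → isZero a ≡ false
  isZero-≉0 {a} a≉0 with a ≟ 0#
  ... | yes a≈0 = ⊥-elim (a≉0 a≈0)
  ... | no _    = refl

  isZero-flips : card F ≡ 2 → ∀ a b → ¬ a - b ≈ 0# → isZero b ≡ not (isZero a)
  isZero-flips card≡2 a b a-b≉0 with a ≟ 0# | b ≟ 0#
  ... | yes a≈0 | yes b≈0 = ⊥-elim (a-b≉0 (x≈y⇒x∙y⁻¹≈ε (trans a≈0 (sym b≈0))))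
  ... | yes _   | no _    = refl
  ... | no _    | yes _   = refl
  ... | no a≉0  | no b≉0  = ⊥-elim (a-b≉0 (x≈y⇒x∙y⁻¹≈ε (trans (≈1 a≉0) (sym (≈1 b≉0)))))
    where
    ≈1 : ∀ {x} → ¬ x ≈ 0# → x ≈ 1#
    ≈1 {x} x≉0 with card≡2⇒≈0⊎≈1 card≡2 x
    ... | inj₁ x≈0 = ⊥-elim (x≉0 x≈0)
    ... | inj₂ x≈1 = x≈1

module SumProperties (F : FiniteField) where
  open CommutativeRing (FiniteField.commRing F) hiding (zero) renaming (refl to ≈-refl)
  open MatrixOps F using (sumFin)
  open CommutativeSemigroupProperties +-commutativeSemigroup using () renaming (interchange to +-interchange)

  sumFin-cong : ∀ n {f g : Fin n → Carrier} → (∀ i → f i ≈ g i) → sumFin n f ≈ sumFin n g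
  sumFin-cong zero    f≈g = ≈-refl
  sumFin-cong (suc n) f≈g = +-cong (f≈g zero) (sumFin-cong n (f≈g ∘ suc))

  sumFin-zero : ∀ n {f : Fin n → Carrier} → (∀ i → f i ≈ 0#) → sumFin n f ≈ 0#
  sumFin-zero zero    f≈0 = ≈-refl
  sumFin-zero (suc n) f≈0 = trans (+-cong (f≈0 zero) (sumFin-zero n (f≈0 ∘ suc))) (+-identityʳ 0#)

  sumFin-single : ∀ n {f : Fin n → Carrier} j → (∀ i → i ≢ j → f i ≈ 0#) → sumFin n f ≈ f j
  sumFin-single (suc n) zero    f≈0 =
    trans (+-congˡ (sumFin-zero n λ i → f≈0 (suc i) λ ())) (+-identityʳ _)
  sumFin-single (suc n) (suc j) f≈0 =
    trans (+-cong (f≈0 zero λ ()) (sumFin-single n j λ i i≢j → f≈0 (suc i) (i≢j ∘ suc-injective)))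
          (+-identityˡ _)

  sumFin-+ : ∀ n (f g : Fin n → Carrier) → sumFin n (λ i → f i + g i) ≈ sumFin n f + sumFin n g
  sumFin-+ zero    f g = sym (+-identityʳ 0#)
  sumFin-+ (suc n) f g = trans (+-congˡ (sumFin-+ n (f ∘ suc) (g ∘ suc))) (+-interchange _ _ _ _)

  sumFin-*ˡ : ∀ n x (f : Fin n → Carrier) → sumFin n (λ i → x * f i) ≈ x * sumFin n f
  sumFin-*ˡ zero    x f = sym (zeroʳ x)
  sumFin-*ˡ (suc n) x f = trans (+-congˡ (sumFin-*ˡ n x (f ∘ suc))) (sym (distribˡ x _ _))

module MatrixProperties (F : FiniteField) where
  open CommutativeRing (FiniteField.commRing F) hiding (zero) renaming (refl to ≈-refl)
  open MatrixOps F
  open SumProperties F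
  open SetoidReasoning setoid

  1M-diag : ∀ {d} (i : Fin d) → 1M i i ≈ 1#
  1M-diag zero    = ≈-refl
  1M-diag (suc i) = 1M-diag i

  1M-offdiag : ∀ {d} {i j : Fin d} → i ≢ j → 1M i j ≈ 0#
  1M-offdiag {i = zero}  {zero}  i≢j = ⊥-elim (i≢j refl)
  1M-offdiag {i = zero}  {suc j} i≢j = ≈-refl
  1M-offdiag {i = suc i} {zero}  i≢j = ≈-refl
  1M-offdiag {i = suc i} {suc j} i≢j = 1M-offdiag (i≢j ∘ ≡.cong suc)

  sumFin-1M-* : ∀ {d} i (f : Fin d → Carrier) → sumFin d (λ j → 1M i j * f j) ≈ f i
  sumFin-1M-* {d} i f = begin
    sumFin d (λ j → 1M i j * f j)
      ≈⟨ sumFin-single d i (λ j j≢i → trans (*-congʳ (1M-offdiag (j≢i ∘ ≡.sym))) (zeroˡ _)) ⟩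
    1M i i * f i                  ≈⟨ trans (*-congʳ (1M-diag i)) (*-identityˡ _) ⟩
    f i                           ∎

  sumFin-*-1M : ∀ {d} k (f : Fin d → Carrier) → sumFin d (λ j → f j * 1M j k) ≈ f k
  sumFin-*-1M {d} k f = begin
    sumFin d (λ j → f j * 1M j k)
      ≈⟨ sumFin-single d k (λ j j≢k → trans (*-congˡ (1M-offdiag j≢k)) (zeroʳ _)) ⟩
    f k * 1M k k                  ≈⟨ trans (*-congˡ (1M-diag k)) (*-identityʳ _) ⟩
    f k                           ∎

  0M : ∀ {d} → Mat d
  0M _ _ = 0#

  ≈M-refl : ∀ {d} {A : Mat d} → A ≈M A
  ≈M-refl i j = ≈-refl

  ≈M-sym : ∀ {d} {A B : Mat d} → A ≈M B → B ≈M A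
  ≈M-sym A≈B i j = sym (A≈B i j)

  ≈M-trans : ∀ {d} {A B C : Mat d} → A ≈M B → B ≈M C → A ≈M C
  ≈M-trans A≈B B≈C i j = trans (A≈B i j) (B≈C i j)

  +M-cong : ∀ {d} {A A′ B B′ : Mat d} → A ≈M A′ → B ≈M B′ → (A +M B) ≈M (A′ +M B′)
  +M-cong A≈A′ B≈B′ i j = +-cong (A≈A′ i j) (B≈B′ i j)

  *M-cong : ∀ {d} {A A′ B B′ : Mat d} → A ≈M A′ → B ≈M B′ → (A *M B) ≈M (A′ *M B′)
  *M-cong {d} A≈A′ B≈B′ i k = sumFin-cong d λ j → *-cong (A≈A′ i j) (B≈B′ j k)

  *M-identityˡ : ∀ {d} (A : Mat d) → (1M *M A) ≈M A
  *M-identityˡ A i k = sumFin-1M-* i (λ j → A j k)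

  *M-zeroˡ : ∀ {d} (A : Mat d) → (0M *M A) ≈M 0M
  *M-zeroˡ {d} A i k = sumFin-zero d λ j → zeroˡ (A j k)

  *M-distribʳ : ∀ {d} (A B C : Mat d) → ((B +M C) *M A) ≈M ((B *M A) +M (C *M A))
  *M-distribʳ {d} A B C i k =
    trans (sumFin-cong d λ j → distribʳ (A j k) (B i j) (C i j)) (sumFin-+ d _ _)

  E : ∀ {d} → Fin d → Fin d → Carrier → Mat d
  E p q a i j = (1M p i * a) * 1M q j

  E-*M : ∀ {d} (p q : Fin d) a (B : Mat d) → (E p q a *M B) ≈M λ i k → (1M p i * a) * B q k
  E-*M {d} p q a B i k = begin
    sumFin d (λ j → ((1M p i * a) * 1M q j) * B j k) ≈⟨ sumFin-cong d (λ j → *-assoc _ _ _) ⟩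
    sumFin d (λ j → (1M p i * a) * (1M q j * B j k)) ≈⟨ sumFin-*ˡ d _ _ ⟩
    (1M p i * a) * sumFin d (λ j → 1M q j * B j k)   ≈⟨ *-congˡ (sumFin-1M-* q (λ j → B j k)) ⟩
    (1M p i * a) * B q k                             ∎

  1+E-*M-1+E : ∀ {d} {p q : Fin d} → p ≢ q → ∀ a b →
               ((1M +M E p q a) *M (1M +M E p q b)) ≈M (1M +M E p q (a + b))
  1+E-*M-1+E {p = p} {q} p≢q a b i k = begin
    ((1M +M E p q a) *M X) i k                     ≈⟨ *M-distribʳ X 1M (E p q a) i k ⟩
    (1M *M X) i k + (E p q a *M X) i k             ≈⟨ +-cong (*M-identityˡ X i k) (E-*M p q a X i k) ⟩
    X i k + (1M p i * a) * X q k                   ≈⟨ +-congˡ (*-congˡ Xqk≈1Mqk) ⟩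
    (1M i k + E p q b i k) + E p q a i k           ≈⟨ +-assoc _ _ _ ⟩
    1M i k + (E p q b i k + E p q a i k)           ≈⟨ +-congˡ (trans (+-comm _ _) (sym (Eab i k))) ⟩
    1M i k + E p q (a + b) i k                     ∎
    where
    X : Mat _
    X = 1M +M E p q b
    Xqk≈1Mqk : X q k ≈ 1M q k
    Xqk≈1Mqk = trans (+-congˡ (trans (*-congʳ (trans (*-congʳ (1M-offdiag p≢q)) (zeroˡ b))) (zeroˡ _)))
                     (+-identityʳ _)
    Eab : ∀ i k → E p q (a + b) i k ≈ E p q a i k + E p q b i k
    Eab i k = trans (*-congʳ (distribˡ _ a b)) (distribʳ _ _ _)

  1+E-inverse : ∀ {d} {p q : Fin d} → p ≢ q → ∀ {a b} → a + b ≈ 0# →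
                ((1M +M E p q a) *M (1M +M E p q b)) ≈M 1M
  1+E-inverse p≢q {a} {b} a+b≈0 i k =
    trans (1+E-*M-1+E p≢q a b i k)
          (trans (+-congˡ (trans (*-congʳ (trans (*-congˡ a+b≈0) (zeroʳ _))) (zeroˡ _))) (+-identityʳ _))

  E-diag : ∀ {d} (p q : Fin d) a → E p p a ≈M (E p q a *M E q p 1#)
  E-diag p q a i k = sym (trans (E-*M p q a (E q p 1#) i k)
                                (*-congˡ (trans (*-congʳ (trans (*-identityʳ _) (1M-diag q))) (*-identityˡ _))))

  sumM : ∀ {d} n → (Fin n → Mat d) → Mat d
  sumM zero    f = 0M
  sumM (suc n) f = f zero +M sumM n (f ∘ suc)

  sumM-entry : ∀ {d} n (f : Fin n → Mat d) i j → sumM n f i j ≡ sumFin n (λ k → f k i j)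
  sumM-entry zero    f i j = refl
  sumM-entry (suc n) f i j = ≡.cong (f zero i j +_) (sumM-entry n (f ∘ suc) i j)

  E-decomposition : ∀ {d} (A : Mat d) → A ≈M sumM d (λ p → sumM d (λ q → E p q (A p q)))
  E-decomposition {d} A i j = sym (begin
    sumM d (λ p → sumM d (λ q → E p q (A p q))) i j      ≡⟨ sumM-entry d _ i j ⟩
    sumFin d (λ p → sumM d (λ q → E p q (A p q)) i j)
      ≈⟨ sumFin-cong d (λ p → reflexive (sumM-entry d _ i j)) ⟩
    sumFin d (λ p → sumFin d (λ q → (1M p i * A p q) * 1M q j))
      ≈⟨ sumFin-cong d (λ p → sumFin-*-1M j (λ q → 1M p i * A p q)) ⟩
    sumFin d (λ p → 1M p i * A p j)                      ≈⟨ sumFin-cong d (λ p → *-comm _ _) ⟩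
    sumFin d (λ p → A p j * 1M p i)                      ≈⟨ sumFin-*-1M i (λ p → A p j) ⟩
    A i j                                                ∎)

  offdiagonal-E-generate : ∀ {d} → 2 ≤ d → (Q : Mat d → Set) →
    (∀ {A B} → A ≈M B → Q A → Q B) → Q 0M →
    (∀ {A B} → Q A → Q B → Q (A +M B)) → (∀ {A B} → Q A → Q B → Q (A *M B)) →
    (∀ {p q} → p ≢ q → ∀ a → Q (E p q a)) → ∀ A → Q A
  offdiagonal-E-generate {d} 2≤d Q resp 0∈ +-closed *-closed offdiagonal∈ A =
    resp (≈M-sym (E-decomposition A)) (sumM∈ λ p → sumM∈ λ q → E∈ p q (A p q))
    where
    sumM∈ : ∀ {n} {f : Fin n → Mat d} → (∀ k → Q (f k)) → Q (sumM n f)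
    sumM∈ {zero}  f∈ = 0∈
    sumM∈ {suc n} f∈ = +-closed (f∈ zero) (sumM∈ (f∈ ∘ suc))
    E∈ : ∀ p q a → Q (E p q a)
    E∈ p q a with p ≟ᶠ q
    ... | no p≢q   = offdiagonal∈ p≢q a
    ... | yes refl =
      let q′ , p≢q′ = ∃-distinct 2≤d p
      in  resp (≈M-sym (E-diag p q′ a))
               (*-closed (offdiagonal∈ p≢q′ a) (offdiagonal∈ (p≢q′ ∘ ≡.sym) 1#))

module SemisimpleProduct (R : Ring 0ℓ 0ℓ) (D : RingDefs.ArtinWedderburn R) where
  open RingDefs.ArtinWedderburn D

  module K (i : Fin s) where
    open CommutativeRing (FiniteField.commRing (Rs i)) public hiding (zero) renaming (refl to ≈-refl)
    open RingProperties ring public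
      using (x+x≈x⇒x≈0; +-inverseʳ-unique; //-rightDividesʳ; //-rightDividesˡ; x≈y⇒x∙y⁻¹≈ε)
    open FiniteFieldProperties (Rs i) public
    open MatrixOps (Rs i) public using (sumFin)
    open SumProperties (Rs i) public

  module M (i : Fin r) where
    open CommutativeRing (FiniteField.commRing (Fs i)) public hiding (zero) renaming (refl to ≈-refl)
    open RingProperties ring public using (x+x≈x⇒x≈0; +-inverseʳ-unique; //-rightDividesʳ; //-rightDividesˡ)
    open MatrixOps (Fs i) public
    open SumProperties (Fs i) public
    open MatrixProperties (Fs i) public

  0ᴷ 1ᴷ : ∀ i → K.Carrier i
  0ᴷ = K.0#
  1ᴷ = K.1#

  0ᴹ 1ᴹ : ∀ i → M.Mat i (d i)
  0ᴹ i = M.0M i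
  1ᴹ i = M.1M i

  0P : P
  0P = 0ᴷ , 0ᴹ

  negP : P → P
  negP (x , X) = (λ i → K.-_ i (x i)) , (λ i k l → M.-_ i (X i k l))

  ≈P-refl : ∀ {p} → p ≈P p
  ≈P-refl = (λ i → K.≈-refl i) , (λ i → M.≈M-refl i)

  ≈P-sym : ∀ {p q} → p ≈P q → q ≈P p
  ≈P-sym (x≈y , X≈Y) = (λ i → K.sym i (x≈y i)) , (λ i → M.≈M-sym i (X≈Y i))

  ≈P-trans : ∀ {p q t} → p ≈P q → q ≈P t → p ≈P t
  ≈P-trans (x≈y , X≈Y) (y≈z , Y≈Z) =
    (λ i → K.trans i (x≈y i) (y≈z i)) , (λ i → M.≈M-trans i (X≈Y i) (Y≈Z i))

  +P-cong : ∀ {p p′ q q′} → p ≈P p′ → q ≈P q′ → (p +P q) ≈P (p′ +P q′)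
  +P-cong (x , X) (y , Y) = (λ i → K.+-cong i (x i) (y i)) , (λ i → M.+M-cong i (X i) (Y i))

  *P-cong : ∀ {p p′ q q′} → p ≈P p′ → q ≈P q′ → (p *P q) ≈P (p′ *P q′)
  *P-cong (x , X) (y , Y) = (λ i → K.*-cong i (x i) (y i)) , (λ i → M.*M-cong i (X i) (Y i))

  negP-cong : ∀ {p q} → p ≈P q → negP p ≈P negP q
  negP-cong (x , X) = (λ i → K.-‿cong i (x i)) , (λ i k l → M.-‿cong i (X i k l))

  p+p≈p⇒p≈0P : ∀ p → (p +P p) ≈P p → p ≈P 0P
  p+p≈p⇒p≈0P p (x , X) = (λ i → K.x+x≈x⇒x≈0 i _ (x i)) , (λ i k l → M.x+x≈x⇒x≈0 i _ (X i k l))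

  +P-inverseʳ-unique : ∀ p q → (p +P q) ≈P 0P → q ≈P negP p
  +P-inverseʳ-unique p q (x , X) =
    (λ i → K.+-inverseʳ-unique i _ _ (x i)) , (λ i k l → M.+-inverseʳ-unique i _ _ (X i k l))

  1P*P1P≈1P : (1P *P 1P) ≈P 1P
  1P*P1P≈1P = (λ i → K.*-identityˡ i (K.1# i)) , (λ i → M.*M-identityˡ i (M.1M i))

  +P-split : ∀ x X → ((x , 0ᴹ) +P (0ᴷ , X)) ≈P (x , X)
  +P-split x X = (λ i → K.+-identityʳ i (x i)) , (λ i k l → M.+-identityˡ i (X i k l))

  injK updK : (c : Fin s) → K.Carrier c → P
  injK c a = updateAt 0ᴷ c a , 0ᴹ
  updK c a = updateAt 1ᴷ c a , 1ᴹ

  injM updM : (c : Fin r) → M.Mat c (d c) → P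
  injM c A = 0ᴷ , updateAt 0ᴹ c A
  updM c A = 1ᴷ , updateAt 1ᴹ c A

  injK-≈0 : ∀ c {a} → K._≈_ c a (K.0# c) → injK c a ≈P 0P
  injK-≈0 c {a} a≈0 =
    (λ j → updateAt-elim (λ j u → K._≈_ j u (K.0# j)) 0ᴷ c a j a≈0 λ _ → K.≈-refl j) ,
    (λ j → M.≈M-refl j)

  updK-inverse : ∀ c {x y} → K._≈_ c (K._*_ c x y) (K.1# c) → (updK c x *P updK c y) ≈P 1P
  updK-inverse c {x} {y} xy≈1 =
    (λ j → updateAt-elim₂ (λ j u v → K._≈_ j (K._*_ j u v) (K.1# j)) 1ᴷ 1ᴷ c x y j xy≈1
                          λ _ → K.*-identityˡ j (K.1# j)) ,
    proj₂ 1P*P1P≈1P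

  updM-inverse : ∀ c {X Y} → M._≈M_ c (M._*M_ c X Y) (M.1M c) → (updM c X *P updM c Y) ≈P 1P
  updM-inverse c {X} {Y} XY≈1 =
    proj₁ 1P*P1P≈1P ,
    (λ j → updateAt-elim₂ (λ j U V → M._≈M_ j (M._*M_ j U V) (M.1M j)) 1ᴹ 1ᴹ c X Y j XY≈1
                          λ _ → M.*M-identityˡ j (M.1M j))

  updK-translate : ∀ c a y → (updK c (K._+_ c a y) +P negP (updK c y)) ≈P injK c a
  updK-translate c a y =
    (λ j → updateAt-elim₃ (λ j u v w → K._≈_ j (K._+_ j u (K.-_ j v)) w) 1ᴷ 1ᴷ 0ᴷ c _ y a j
                          (K.//-rightDividesʳ c y a) λ _ → K.-‿inverseʳ j (K.1# j)) ,
    (λ j k l → M.-‿inverseʳ j (M.1M j k l))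

  updM-translate : ∀ c A → (updM c (M._+M_ c (M.1M c) A) +P negP 1P) ≈P injM c A
  updM-translate c A =
    (λ j → K.-‿inverseʳ j (K.1# j)) ,
    (λ j → updateAt-elim₂ (λ j U V → ∀ k l → M._≈_ j (M._+_ j (U k l) (M.-_ j (M.1M j k l))) (V k l))
                          1ᴹ 0ᴹ c _ A j
                          (λ k l → M.trans c (M.+-congʳ c (M.+-comm c _ _)) (M.//-rightDividesʳ c _ _))
                          λ _ k l → M.-‿inverseʳ j (M.1M j k l))

  injM-cong : ∀ c {A B} → M._≈M_ c A B → injM c A ≈P injM c B
  injM-cong c {A} {B} A≈B =
    (λ j → K.≈-refl j) ,
    (λ j → updateAt-elim₂ (λ j U V → M._≈M_ j U V) 0ᴹ 0ᴹ c A B j A≈B λ _ → M.≈M-refl j)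

  injM-0M : ∀ c → 0P ≈P injM c (M.0M c)
  injM-0M c =
    (λ j → K.≈-refl j) ,
    (λ j → updateAt-elim (λ j U → M._≈M_ j (M.0M j) U) 0ᴹ c _ j (M.≈M-refl c) λ _ → M.≈M-refl j)

  injM-+M : ∀ c A B → (injM c A +P injM c B) ≈P injM c (M._+M_ c A B)
  injM-+M c A B =
    (λ j → K.+-identityʳ j (K.0# j)) ,
    (λ j → updateAt-elim₃ (λ j U V W → M._≈M_ j (M._+M_ j U V) W) 0ᴹ 0ᴹ 0ᴹ c A B _ j
                          (M.≈M-refl c) λ _ k l → M.+-identityʳ j (M.0# j))

  injM-*M : ∀ c A B → (injM c A *P injM c B) ≈P injM c (M._*M_ c A B)
  injM-*M c A B =
    (λ j → K.zeroˡ j (K.0# j)) ,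
    (λ j → updateAt-elim₃ (λ j U V W → M._≈M_ j (M._*M_ j U V) W) 0ᴹ 0ᴹ 0ᴹ c A B _ j
                          (M.≈M-refl c) λ _ → M.*M-zeroˡ j (M.0M j))

  sumP : ∀ n → (Fin n → P) → P
  sumP zero    f = 0P
  sumP (suc n) f = f zero +P sumP n (f ∘ suc)

  proj₁-sumP : ∀ n (f : Fin n → P) j → proj₁ (sumP n f) j ≡ K.sumFin j n (λ i → proj₁ (f i) j)
  proj₁-sumP zero    f j = refl
  proj₁-sumP (suc n) f j = ≡.cong (K._+_ j (proj₁ (f zero) j)) (proj₁-sumP n (f ∘ suc) j)

  proj₂-sumP : ∀ n (f : Fin n → P) j k l → proj₂ (sumP n f) j k l ≡ M.sumFin j n (λ i → proj₂ (f i) j k l)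
  proj₂-sumP zero    f j k l = refl
  proj₂-sumP (suc n) f j k l = ≡.cong (M._+_ j (proj₂ (f zero) j k l)) (proj₂-sumP n (f ∘ suc) j k l)

  sumP-injK : ∀ x → sumP s (λ i → injK i (x i)) ≈P (x , 0ᴹ)
  sumP-injK x =
    (λ j → K.trans j (K.reflexive j (proj₁-sumP s _ j))
             (K.trans j (K.sumFin-single j s j λ i i≢j → K.reflexive j (updateAt-minimal 0ᴷ i (x i) j i≢j))
                        (K.reflexive j (updateAt-updates 0ᴷ j (x j))))) ,
    (λ j k l → M.trans j (M.reflexive j (proj₂-sumP s _ j k l)) (M.sumFin-zero j s λ _ → M.≈-refl j))

  sumP-injM : ∀ X → sumP r (λ i → injM i (X i)) ≈P (0ᴷ , X)
  sumP-injM X =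
    (λ j → K.trans j (K.reflexive j (proj₁-sumP r _ j)) (K.sumFin-zero j r λ _ → K.≈-refl j)) ,
    (λ j k l → M.trans j (M.reflexive j (proj₂-sumP r _ j k l))
                 (M.trans j (M.sumFin-single j r j λ i i≢j →
                                M.reflexive j (entry (updateAt-minimal 0ᴹ i (X i) j i≢j)))
                            (M.reflexive j (entry (updateAt-updates 0ᴹ j (X j))))))
    where
    entry : ∀ {j} {U V : M.Mat j (d j)} {k l} → U ≡ V → U k l ≡ V k l
    entry {k = k} {l} = ≡.cong λ U → U k l

  agree-at-the-𝔽₂-component : AtMostOneF₂ → ∀ {x y : ∀ i → K.Carrier i} {i₀} → card (Rs i₀) ≡ 2 →
    K._≈_ i₀ (x i₀) (y i₀) → ∀ i → card (Rs i) ≡ 2 → K._≈_ i (x i) (y i)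
  agree-at-the-𝔽₂-component atMostOne {i₀ = i₀} card≡2 xᵢ₀≈yᵢ₀ i card≡2′
    with atMostOne i i₀ card≡2′ card≡2
  ... | refl = xᵢ₀≈yᵢ₀

  record IsSubringContainingUnits (T : P → Set) : Set where
    field
      resp       : ∀ {p q} → p ≈P q → T p → T q
      0∈         : T 0P
      +-closed   : ∀ {p q} → T p → T q → T (p +P q)
      neg-closed : ∀ {p} → T p → T (negP p)
      *-closed   : ∀ {p q} → T p → T q → T (p *P q)
      units⊆     : ∀ {p q} → (p *P q) ≈P 1P → (q *P p) ≈P 1P → T p

  module SubringContainingUnits {T : P → Set} (isT : IsSubringContainingUnits T) where
    open IsSubringContainingUnits isT

    1∈ : T 1P
    1∈ = units⊆ 1P*P1P≈1P 1P*P1P≈1P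

    -‿closed : ∀ {p q} → T p → T q → T (p +P negP q)
    -‿closed Tp Tq = +-closed Tp (neg-closed Tq)

    sumP∈ : ∀ {n} {f : Fin n → P} → (∀ i → T (f i)) → T (sumP n f)
    sumP∈ {zero}  f∈ = 0∈
    sumP∈ {suc n} f∈ = +-closed (f∈ zero) (sumP∈ (f∈ ∘ suc))

    updK∈ : ∀ c {x} → ¬ K._≈_ c x (K.0# c) → T (updK c x)
    updK∈ c x≉0 =
      let y , xy≈1 = FiniteField.inverse (Rs c) _ x≉0
      in  units⊆ (updK-inverse c xy≈1) (updK-inverse c (K.trans c (K.*-comm c _ _) xy≈1))

    injK∈ : ∀ c → card (Rs c) ≢ 2 → ∀ a → T (injK c a)
    injK∈ c card≢2 a =
      let y , y≉0 , a+y≉0 = K.card≢2⇒nonzero-translate c card≢2 a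
      in  resp (updK-translate c a y) (-‿closed (updK∈ c a+y≉0) (updK∈ c y≉0))

    injM∈ : ∀ c A → T (injM c A)
    injM∈ c = M.offdiagonal-E-generate c (d≥2 c) (T ∘ injM c)
      (resp ∘ injM-cong c) (resp (injM-0M c) 0∈)
      (λ TA TB → resp (injM-+M c _ _) (+-closed TA TB))
      (λ TA TB → resp (injM-*M c _ _) (*-closed TA TB))
      offdiagonal∈
      where
      offdiagonal∈ : ∀ {p q} → p ≢ q → ∀ a → T (injM c (M.E c p q a))
      offdiagonal∈ p≢q a = resp (updM-translate c _) (-‿closed (units⊆
        (updM-inverse c (M.1+E-inverse c p≢q (M.-‿inverseʳ c a)))
        (updM-inverse c (M.1+E-inverse c p≢q (M.-‿inverseˡ c a)))) 1∈)

    agreeing-on-𝔽₂-components : ∀ p t → T t →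
      (∀ i → card (Rs i) ≡ 2 → K._≈_ i (proj₁ p i) (proj₁ t i)) → T p
    agreeing-on-𝔽₂-components p t Tt p≈t = resp p-t+t≈p (+-closed p-t∈ Tt)
      where
      p-t : P
      p-t = p +P negP t
      p-t+t≈p : (p-t +P t) ≈P p
      p-t+t≈p = (λ i → K.//-rightDividesˡ i _ _) , (λ i k l → M.//-rightDividesˡ i _ _)
      fieldPart∈ : ∀ i → T (injK i (proj₁ p-t i))
      fieldPart∈ i with card (Rs i) ≟ⁿ 2
      ... | no card≢2  = injK∈ i card≢2 _
      ... | yes card≡2 = resp (≈P-sym (injK-≈0 i (K.x≈y⇒x∙y⁻¹≈ε i (p≈t i card≡2)))) 0∈
      matrixPart∈ : ∀ i → T (injM i (proj₂ p-t i))
      matrixPart∈ i = injM∈ i _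
      p-t∈ : T p-t
      p-t∈ = resp (+P-split _ _)
        (+-closed (resp (sumP-injK _) (sumP∈ fieldPart∈)) (resp (sumP-injM _) (sumP∈ matrixPart∈)))

    all∈ : AtMostOneF₂ → ∀ p → T p
    all∈ atMostOne p with any? (λ i → card (Rs i) ≟ⁿ 2)
    ... | no no𝔽₂ = agreeing-on-𝔽₂-components p 0P 0∈ λ i card≡2 → ⊥-elim (no𝔽₂ (i , card≡2))
    ... | yes (i₀ , card≡2) with K.card≡2⇒≈0⊎≈1 i₀ card≡2 (proj₁ p i₀)
    ...   | inj₁ pᵢ₀≈0 =
      agreeing-on-𝔽₂-components p 0P 0∈ (agree-at-the-𝔽₂-component atMostOne card≡2 pᵢ₀≈0)
    ...   | inj₂ pᵢ₀≈1 =
      agreeing-on-𝔽₂-components p 1P 1∈ (agree-at-the-𝔽₂-component atMostOne card≡2 pᵢ₀≈1)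

module Units (R : Ring 0ℓ 0ℓ) where
  open Ring R
  open RingDefs R using (IsUnit)
  open RingProperties R using (-‿distribˡ-*; -‿distribʳ-*; -‿involutive)
  open SetoidReasoning setoid

  IsUnit-resp : ∀ {x y} → x ≈ y → IsUnit x → IsUnit y
  IsUnit-resp x≈y (v , xv≈1 , vx≈1) = v , trans (*-congʳ (sym x≈y)) xv≈1 , trans (*-congˡ (sym x≈y)) vx≈1

  IsUnit-1 : IsUnit 1#
  IsUnit-1 = 1# , *-identityˡ 1# , *-identityˡ 1#

  IsUnit-neg : ∀ {u} → IsUnit u → IsUnit (- u)
  IsUnit-neg {u} (v , uv≈1 , vu≈1) = - v , -*- uv≈1 , -*- vu≈1
    where
    -*- : ∀ {a b} → a * b ≈ 1# → - a * - b ≈ 1#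
    -*- {a} {b} ab≈1 = begin
      - a * - b    ≈⟨ -‿distribˡ-* a (- b) ⟨
      - (a * - b)  ≈⟨ -‿cong (-‿distribʳ-* a b) ⟨
      - - (a * b)  ≈⟨ -‿involutive (a * b) ⟩
      a * b        ≈⟨ ab≈1 ⟩
      1#           ∎

  IsUnit-* : ∀ {u v} → IsUnit u → IsUnit v → IsUnit (u * v)
  IsUnit-* (u′ , uu′≈1 , u′u≈1) (v′ , vv′≈1 , v′v≈1) =
    v′ * u′ , cancel uu′≈1 vv′≈1 , cancel v′v≈1 u′u≈1
    where
    cancel : ∀ {a b c e} → a * e ≈ 1# → b * c ≈ 1# → (a * b) * (c * e) ≈ 1#
    cancel {a} {b} {c} {e} ae≈1 bc≈1 = begin
      (a * b) * (c * e)  ≈⟨ *-assoc a b (c * e) ⟩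
      a * (b * (c * e))  ≈⟨ *-congˡ (*-assoc b c e) ⟨
      a * ((b * c) * e)  ≈⟨ *-congˡ (trans (*-congʳ bc≈1) (*-identityˡ e)) ⟩
      a * e              ≈⟨ ae≈1 ⟩
      1#                 ∎

  invertible⇒IsUnit : ∀ {x a b} → x * a ≈ 1# → b * x ≈ 1# → IsUnit x
  invertible⇒IsUnit {x} {a} {b} xa≈1 bx≈1 = a , xa≈1 , trans (*-congʳ a≈b) bx≈1
    where
    a≈b : a ≈ b
    a≈b = begin
      a             ≈⟨ *-identityˡ a ⟨
      1# * a        ≈⟨ *-congʳ bx≈1 ⟨
      (b * x) * a   ≈⟨ *-assoc b x a ⟩
      b * (x * a)   ≈⟨ *-congˡ xa≈1 ⟩
      b * 1#        ≈⟨ *-identityʳ b ⟩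
      b             ∎

module SumsOfUnits (R : Ring 0ℓ 0ℓ) where
  open Ring R hiding (zero)
  open RingDefs R using (IsUnit; Adj; Connected)
  open RingProperties R using (-‿+-comm; -0#≈0#; //-rightDividesˡ)
  open Units R
  open SetoidReasoning setoid

  data SumOfUnits : Carrier → Set where
    0ˢ      : SumOfUnits 0#
    _+unit_ : ∀ {x u} → SumOfUnits x → IsUnit u → SumOfUnits (x + u)
    respˢ   : ∀ {x y} → x ≈ y → SumOfUnits x → SumOfUnits y

  unit : ∀ {u} → IsUnit u → SumOfUnits u
  unit U = respˢ (+-identityˡ _) (0ˢ +unit U)

  _+ˢ_ : ∀ {x y} → SumOfUnits x → SumOfUnits y → SumOfUnits (x + y)
  Sx +ˢ 0ˢ           = respˢ (sym (+-identityʳ _)) Sx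
  Sx +ˢ (Sy +unit U) = respˢ (+-assoc _ _ _) ((Sx +ˢ Sy) +unit U)
  Sx +ˢ respˢ y≈z Sy = respˢ (+-congˡ y≈z) (Sx +ˢ Sy)

  -ˢ_ : ∀ {x} → SumOfUnits x → SumOfUnits (- x)
  -ˢ 0ˢ           = respˢ (sym -0#≈0#) 0ˢ
  -ˢ (Sx +unit U) = respˢ (-‿+-comm _ _) ((-ˢ Sx) +unit IsUnit-neg U)
  -ˢ respˢ x≈y Sx = respˢ (-‿cong x≈y) (-ˢ Sx)

  _*unit_ : ∀ {x u} → SumOfUnits x → IsUnit u → SumOfUnits (x * u)
  0ˢ           *unit U = respˢ (sym (zeroˡ _)) 0ˢ
  (Sx +unit V) *unit U = respˢ (sym (distribʳ _ _ _)) ((Sx *unit U) +ˢ unit (IsUnit-* V U))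
  respˢ x≈y Sx *unit U = respˢ (*-congʳ x≈y) (Sx *unit U)

  _*ˢ_ : ∀ {x y} → SumOfUnits x → SumOfUnits y → SumOfUnits (x * y)
  Sx *ˢ 0ˢ           = respˢ (sym (zeroʳ _)) 0ˢ
  Sx *ˢ (Sy +unit U) = respˢ (sym (distribˡ _ _ _)) ((Sx *ˢ Sy) +ˢ (Sx *unit U))
  Sx *ˢ respˢ y≈z Sy = respˢ (*-congˡ y≈z) (Sx *ˢ Sy)

  x-[x+y]≈-y : ∀ x y → x - (x + y) ≈ - y
  x-[x+y]≈-y x y = begin
    x - (x + y)      ≈⟨ +-congˡ (-‿+-comm x y) ⟨
    x + (- x + - y)  ≈⟨ +-assoc x (- x) (- y) ⟨
    (x - x) + - y    ≈⟨ +-congʳ (-‿inverseʳ x) ⟩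
    0# + - y         ≈⟨ +-identityˡ (- y) ⟩
    - y              ∎

  path-to-translate : ∀ {z} → SumOfUnits z → ∀ a → ∃[ c ] (Star Adj a c × c ≈ a + z)
  path-to-translate 0ˢ           a = a , ε , sym (+-identityʳ a)
  path-to-translate (Sz +unit U) a =
    let c , a⇝c , c≈a+z = path-to-translate Sz a
    in  c + _ , a⇝c ◅◅ (adj ◅ ε) , trans (+-congʳ c≈a+z) (+-assoc a _ _)
    where
    adj : ∀ {c} → Adj c (c + _)
    adj {c} = IsUnit-resp (sym (x-[x+y]≈-y c _)) (IsUnit-neg U)
  path-to-translate (respˢ z≈z′ Sz) a =
    let c , a⇝c , c≈a+z = path-to-translate Sz a
    in  c , a⇝c , trans c≈a+z (+-congˡ z≈z′)

  all-SumOfUnits⇒Connected : (∀ x → SumOfUnits x) → Connected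
  all-SumOfUnits⇒Connected S a b =
    let c , a⇝c , c≈a+[b-a] = path-to-translate (S (b - a)) a
    in  c , a⇝c , trans c≈a+[b-a] (trans (+-comm a _) (//-rightDividesˡ a b))

module MaximalLeftIdeals (R : Ring 0ℓ 0ℓ) (finite : FiniteRing R) where
  open Ring R hiding (zero)
  open RingDefs R using (IsLeftIdeal; IsMaximalLeftIdeal)
  open RingProperties R using (-‿distribˡ-*; -‿+-comm; -0#≈0#; //-rightDividesˡ; x[y-z]≈xy-xz)
  open FiniteSetoidProperties isEquivalence finite using (∃?)
  open IsFiniteSetoid finite using (size; toFin; fromFin; from-to)
  open CommutativeSemigroupProperties +-commutativeSemigroup using () renaming (interchange to +-interchange)

  record DecidableProperLeftIdeal : Set₁ where
    field
      member      : Carrier → Set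
      member?     : ∀ x → Dec (member x)
      isLeftIdeal : IsLeftIdeal member
      proper      : ¬ member 1#
    open IsLeftIdeal isLeftIdeal public

  x-0*e≈x : ∀ x e → x - 0# * e ≈ x
  x-0*e≈x x e = trans (+-congˡ (trans (-‿cong (zeroˡ e)) -0#≈0#)) (+-identityʳ x)

  module Adjoin (I : DecidableProperLeftIdeal) (e : Carrier) where
    open DecidableProperLeftIdeal I

    I+Re : Carrier → Set
    I+Re x = ∃[ r ] member (x - r * e)

    I+Re? : ∀ x → Dec (I+Re x)
    I+Re? x = ∃? _ (λ r≈r′ → resp (+-congˡ (-‿cong (*-congʳ r≈r′)))) (λ r → member? _)

    I+Re-isLeftIdeal : IsLeftIdeal I+Re
    I+Re-isLeftIdeal = record
      { resp       = λ x≈y (r , h) → r , resp (+-congʳ x≈y) h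
      ; zero∈      = 0# , resp (sym (x-0*e≈x 0# e)) zero∈
      ; +-closed   = λ {x} {y} (r , h) (r′ , h′) → r + r′ ,
          resp (trans (+-interchange x _ y _)
                      (+-congˡ (trans (-‿+-comm _ _) (-‿cong (sym (distribʳ e r r′))))))
               (+-closed h h′)
      ; neg-closed = λ {x} (r , h) → - r ,
          resp (trans (sym (-‿+-comm x _)) (+-congˡ (-‿cong (-‿distribˡ-* r e)))) (neg-closed h)
      ; *-closed   = λ t {x} (r , h) → t * r ,
          resp (trans (x[y-z]≈xy-xz t x (r * e)) (+-congˡ (-‿cong (sym (*-assoc t r e))))) (*-closed t h)
      }

  open DecidableProperLeftIdeal using () renaming (member to ⟦_⟧)

  _⊆_ : (Carrier → Set) → (Carrier → Set) → Set
  P ⊆ Q = ∀ {x} → P x → Q x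

  extend : DecidableProperLeftIdeal → Carrier → DecidableProperLeftIdeal
  extend I e with Adjoin.I+Re? I e 1#
  ... | yes _   = I
  ... | no 1∉I+Re = record
    { member      = Adjoin.I+Re I e
    ; member?     = Adjoin.I+Re? I e
    ; isLeftIdeal = Adjoin.I+Re-isLeftIdeal I e
    ; proper      = 1∉I+Re
    }

  extend-⊇ : ∀ I e → ⟦ I ⟧ ⊆ ⟦ extend I e ⟧
  extend-⊇ I e {x} x∈I with Adjoin.I+Re? I e 1#
  ... | yes _ = x∈I
  ... | no _  = 0# , DecidableProperLeftIdeal.resp I (sym (x-0*e≈x x e)) x∈I

  extend-decides : ∀ I e → ⟦ extend I e ⟧ e ⊎ ∃[ r ] ⟦ I ⟧ (1# - r * e)
  extend-decides I e with Adjoin.I+Re? I e 1#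
  ... | yes 1∈I+Re = inj₂ 1∈I+Re
  ... | no _       = inj₁ (1# , resp (sym e-1*e≈0) zero∈)
    where
    open DecidableProperLeftIdeal I
    e-1*e≈0 : e - 1# * e ≈ 0#
    e-1*e≈0 = trans (+-congˡ (-‿cong (*-identityˡ e))) (-‿inverseʳ e)

  extendAll : ∀ m → (Fin m → Carrier) → DecidableProperLeftIdeal → DecidableProperLeftIdeal
  extendAll zero    f I = I
  extendAll (suc m) f I = extendAll m (f ∘ suc) (extend I (f zero))

  extendAll-⊇ : ∀ m f I → ⟦ I ⟧ ⊆ ⟦ extendAll m f I ⟧
  extendAll-⊇ zero    f I = λ x∈I → x∈I
  extendAll-⊇ (suc m) f I = extendAll-⊇ m (f ∘ suc) _ ∘ extend-⊇ I (f zero)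

  extendAll-decides : ∀ m f I (i : Fin m) →
    ⟦ extendAll m f I ⟧ (f i) ⊎ ∃[ r ] ⟦ extendAll m f I ⟧ (1# - r * f i)
  extendAll-decides (suc m) f I zero with extend-decides I (f zero)
  ... | inj₁ fᵢ∈J    = inj₁ (extendAll-⊇ m (f ∘ suc) _ fᵢ∈J)
  ... | inj₂ (r , h) = inj₂ (r , extendAll-⊇ m (f ∘ suc) _ (extend-⊇ I (f zero) h))
  extendAll-decides (suc m) f I (suc i) = extendAll-decides m (f ∘ suc) (extend I (f zero)) i

  -- Adjoining the elements one by one, each is either absorbed or refused because
  -- 1 - r e already lies in the ideal; so no proper left ideal can be strictly larger.
  maximal-extension : (I : DecidableProperLeftIdeal) →
    Σ[ M ∈ (Carrier → Set) ] (IsMaximalLeftIdeal M × ⟦ I ⟧ ⊆ M)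
  maximal-extension I = ⟦ M ⟧ , isMaximal , extendAll-⊇ size fromFin I
    where
    M : DecidableProperLeftIdeal
    M = extendAll size fromFin I
    isMaximal : IsMaximalLeftIdeal ⟦ M ⟧
    isMaximal = record
      { isLeftIdeal = DecidableProperLeftIdeal.isLeftIdeal M
      ; proper      = DecidableProperLeftIdeal.proper M
      ; maximal     = maximal
      }
      where
      maximal : ∀ J → IsLeftIdeal J → ⟦ M ⟧ ⊆ J → ¬ J 1# → J ⊆ ⟦ M ⟧
      maximal J isJ M⊆J 1∉J {x} x∈J with extendAll-decides size fromFin I (toFin x)
      ... | inj₁ x′∈M    = DecidableProperLeftIdeal.resp M (from-to x) x′∈M
      ... | inj₂ (r , h) = ⊥-elim (1∉J (resp (//-rightDividesˡ _ 1#) (+-closed (M⊆J h) (*-closed r x′∈J))))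
        where
        open IsLeftIdeal isJ
        x′∈J : J (fromFin (toFin x))
        x′∈J = resp (sym (from-to x)) x∈J

module JacobsonRadical (R : Ring 0ℓ 0ℓ) (finite : FiniteRing R) where
  open Ring R hiding (zero)
  open RingDefs R using (IsLeftIdeal; IsMaximalLeftIdeal; Rad; IsUnit)
  open RingProperties R using (-‿distribˡ-*; //-rightDividesʳ)
  open FiniteSetoidProperties isEquivalence finite using (_≟_; ∃?)
  open MaximalLeftIdeals R finite
  open SetoidReasoning setoid

  principal : ∀ u → ¬ (∃[ y ] y * u ≈ 1#) → DecidableProperLeftIdeal
  principal u ¬invertible = record
    { member      = λ x → ∃[ r ] x ≈ r * u
    ; member?     = λ x → ∃? _ (λ r≈r′ x≈ru → trans x≈ru (*-congʳ r≈r′)) (λ r → x ≟ r * u)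
    ; isLeftIdeal = record
      { resp       = λ x≈y (r , x≈ru) → r , trans (sym x≈y) x≈ru
      ; zero∈      = 0# , sym (zeroˡ u)
      ; +-closed   = λ (r , x≈ru) (r′ , y≈r′u) →
          r + r′ , trans (+-cong x≈ru y≈r′u) (sym (distribʳ u r r′))
      ; neg-closed = λ (r , x≈ru) → - r , trans (-‿cong x≈ru) (-‿distribˡ-* r u)
      ; *-closed   = λ t (r , x≈ru) → t * r , trans (*-congˡ x≈ru) (sym (*-assoc t r u))
      }
    ; proper      = λ (r , 1≈ru) → ¬invertible (r , sym 1≈ru)
    }

  Rad-*-closed : ∀ t {z} → Rad z → Rad (t * z)
  Rad-*-closed t z∈Rad I isMax = IsLeftIdeal.*-closed (IsMaximalLeftIdeal.isLeftIdeal isMax) t (z∈Rad I isMax)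

  Rad-neg-closed : ∀ {z} → Rad z → Rad (- z)
  Rad-neg-closed z∈Rad I isMax = IsLeftIdeal.neg-closed (IsMaximalLeftIdeal.isLeftIdeal isMax) (z∈Rad I isMax)

  -- Otherwise R(1 + z) lies in a maximal left ideal, which also contains z, hence 1.
  1+Rad-left-invertible : ∀ {z} → Rad z → ∃[ y ] y * (1# + z) ≈ 1#
  1+Rad-left-invertible {z} z∈Rad
    with ∃? (λ y → y * (1# + z) ≈ 1#) (λ y≈y′ → trans (*-congʳ (sym y≈y′))) (λ y → _ ≟ 1#)
  ... | yes invertible  = invertible
  ... | no ¬invertible =
    let M , isMax , R[1+z]⊆M = maximal-extension (principal (1# + z) ¬invertible)
        open IsLeftIdeal (IsMaximalLeftIdeal.isLeftIdeal isMax)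
    in  ⊥-elim (IsMaximalLeftIdeal.proper isMax
          (resp (//-rightDividesʳ z 1#)
                (+-closed (R[1+z]⊆M (1# , sym (*-identityˡ _))) (neg-closed (z∈Rad M isMax)))))

  1+Rad-IsUnit : ∀ {z} → Rad z → IsUnit (1# + z)
  1+Rad-IsUnit {z} z∈Rad = y , trans (*-congʳ 1+z≈w) wy≈1 , y[1+z]≈1
    where
    y : Carrier
    y = proj₁ (1+Rad-left-invertible z∈Rad)
    y[1+z]≈1 : y * (1# + z) ≈ 1#
    y[1+z]≈1 = proj₂ (1+Rad-left-invertible z∈Rad)
    y≈1-yz : y ≈ 1# + - (y * z)
    y≈1-yz = begin
      y                        ≈⟨ //-rightDividesʳ (y * z) y ⟨
      (y + y * z) - y * z      ≈⟨ +-congʳ (+-congʳ (*-identityʳ y)) ⟨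
      (y * 1# + y * z) - y * z ≈⟨ +-congʳ (distribˡ y 1# z) ⟨
      y * (1# + z) - y * z     ≈⟨ +-congʳ y[1+z]≈1 ⟩
      1# - y * z               ∎
    w : Carrier
    w = proj₁ (1+Rad-left-invertible (Rad-neg-closed (Rad-*-closed y z∈Rad)))
    wy≈1 : w * y ≈ 1#
    wy≈1 = trans (*-congˡ y≈1-yz) (proj₂ (1+Rad-left-invertible (Rad-neg-closed (Rad-*-closed y z∈Rad))))
    1+z≈w : 1# + z ≈ w
    1+z≈w = begin
      1# + z              ≈⟨ *-identityˡ _ ⟨
      1# * (1# + z)       ≈⟨ *-congʳ wy≈1 ⟨
      (w * y) * (1# + z)  ≈⟨ *-assoc w y _ ⟩
      w * (y * (1# + z))  ≈⟨ *-congˡ y[1+z]≈1 ⟩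
      w * 1#              ≈⟨ *-identityʳ w ⟩
      w                   ∎

module Theorem (R : Ring 0ℓ 0ℓ) (finite : FiniteRing R) (D : RingDefs.ArtinWedderburn R) where
  open Ring R hiding (zero; refl)
  open RingDefs R
  open RingDefs.ArtinWedderburn D
  open RingProperties R using (x≈y⇒x∙y⁻¹≈ε; //-rightDividesˡ; //-rightDividesʳ)
  open SemisimpleProduct R D
  open Units R
  open SumsOfUnits R
  open JacobsonRadical R finite

  ≈⇒Rad : ∀ {x y} → x ≈ y → Rad (x - y)
  ≈⇒Rad x≈y I isMax = resp (sym (x≈y⇒x∙y⁻¹≈ε x≈y)) zero∈
    where open IsLeftIdeal (IsMaximalLeftIdeal.isLeftIdeal isMax)

  φ-resp : ∀ {x y} → x ≈ y → φ x ≈P φ y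
  φ-resp = φ-cong ∘ ≈⇒Rad

  φ-0 : φ 0# ≈P 0P
  φ-0 = p+p≈p⇒p≈0P (φ 0#) (≈P-trans (≈P-sym (φ-+ 0# 0#)) (φ-resp (+-identityʳ 0#)))

  φ-neg : ∀ x → φ (- x) ≈P negP (φ x)
  φ-neg x = +P-inverseʳ-unique (φ x) (φ (- x))
    (≈P-trans (≈P-sym (φ-+ x (- x))) (≈P-trans (φ-resp (-‿inverseʳ x)) φ-0))

  Rad⊆SumOfUnits : ∀ {z} → Rad z → SumOfUnits z
  Rad⊆SumOfUnits z∈Rad = respˢ (trans (+-congʳ (+-comm 1# _)) (//-rightDividesʳ 1# _))
    (unit (1+Rad-IsUnit z∈Rad) +ˢ (-ˢ unit IsUnit-1))

  φ≈1P⇒IsUnit : ∀ {a} → φ a ≈P 1P → IsUnit a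
  φ≈1P⇒IsUnit φa≈1 = IsUnit-resp (trans (+-comm 1# _) (//-rightDividesˡ 1# _))
                                 (1+Rad-IsUnit (φ-inj (≈P-trans φa≈1 (≈P-sym φ-1))))

  φ-reflects-units : ∀ {x q} → (φ x *P q) ≈P 1P → (q *P φ x) ≈P 1P → IsUnit x
  φ-reflects-units {x} {q} φx*q≈1 q*φx≈1 =
    let y , φy≈q = φ-surj q
        v , xyv≈1 , _ = φ≈1P⇒IsUnit (≈P-trans (φ-* x y) (≈P-trans (*P-cong ≈P-refl φy≈q) φx*q≈1))
        w , _ , wyx≈1 = φ≈1P⇒IsUnit (≈P-trans (φ-* y x) (≈P-trans (*P-cong φy≈q ≈P-refl) q*φx≈1))
    in  invertible⇒IsUnit (trans (sym (*-assoc x y v)) xyv≈1) (trans (*-assoc w y x) wyx≈1)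

  ImageOfSumsOfUnits : P → Set
  ImageOfSumsOfUnits p = ∃[ x ] (SumOfUnits x × φ x ≈P p)

  ImageOfSumsOfUnits-isSubringContainingUnits : IsSubringContainingUnits ImageOfSumsOfUnits
  ImageOfSumsOfUnits-isSubringContainingUnits = record
    { resp       = λ p≈q (x , Sx , φx≈p) → x , Sx , ≈P-trans φx≈p p≈q
    ; 0∈         = 0# , 0ˢ , φ-0
    ; +-closed   = λ (x , Sx , φx≈p) (y , Sy , φy≈q) →
        x + y , Sx +ˢ Sy , ≈P-trans (φ-+ x y) (+P-cong φx≈p φy≈q)
    ; neg-closed = λ (x , Sx , φx≈p) → - x , -ˢ Sx , ≈P-trans (φ-neg x) (negP-cong φx≈p)
    ; *-closed   = λ (x , Sx , φx≈p) (y , Sy , φy≈q) →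
        x * y , Sx *ˢ Sy , ≈P-trans (φ-* x y) (*P-cong φx≈p φy≈q)
    ; units⊆     = λ {p} pq≈1 qp≈1 →
        let x , φx≈p = φ-surj p
        in  x , unit (φ-reflects-units (≈P-trans (*P-cong φx≈p ≈P-refl) pq≈1)
                                       (≈P-trans (*P-cong ≈P-refl φx≈p) qp≈1))
              , φx≈p
    }

  atMostOneF₂⇒all-SumOfUnits : AtMostOneF₂ → ∀ x → SumOfUnits x
  atMostOneF₂⇒all-SumOfUnits atMostOne x =
    let open SubringContainingUnits ImageOfSumsOfUnits-isSubringContainingUnits using (all∈)
        y , Sy , φy≈φx = all∈ atMostOne (φ x)
    in  respˢ (//-rightDividesˡ y x) (Rad⊆SumOfUnits (φ-inj (≈P-sym φy≈φx)) +ˢ Sy)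

  component : ∀ i → Carrier → K.Carrier i
  component i x = proj₁ (φ x) i

  IsUnit⇒component≉0 : ∀ i {u} → IsUnit u → ¬ K._≈_ i (component i u) (K.0# i)
  IsUnit⇒component≉0 i {u} (v , uv≈1 , _) uᵢ≈0 = FiniteField.nontrivial (Rs i) (begin
    K.1# i                                   ≈⟨ proj₁ (≈P-trans (φ-resp uv≈1) φ-1) i ⟨
    component i (u * v)                      ≈⟨ proj₁ (φ-* u v) i ⟩
    K._*_ i (component i u) (component i v)  ≈⟨ K.*-congʳ i uᵢ≈0 ⟩
    K._*_ i (K.0# i) (component i v)         ≈⟨ K.zeroˡ i _ ⟩
    K.0# i                                   ∎)
    where open SetoidReasoning (K.setoid i)

  isZeroAt : Fin s → Carrier → Bool
  isZeroAt i x = K.isZero i (component i x)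

  Adj⇒isZeroAt-flips : ∀ i → card (Rs i) ≡ 2 → ∀ {x y} → Adj x y → isZeroAt i y ≡ not (isZeroAt i x)
  Adj⇒isZeroAt-flips i card≡2 {x} {y} x-y∈R× = K.isZero-flips i card≡2 _ _ λ xᵢ-yᵢ≈0 →
    IsUnit⇒component≉0 i x-y∈R×
      (K.trans i (K.trans i (proj₁ (φ-+ x (- y)) i) (K.+-congˡ i (proj₁ (φ-neg y) i))) xᵢ-yᵢ≈0)

  parity : Fin s → Fin s → Carrier → Bool
  parity i j x = isZeroAt i x xor isZeroAt j x

  parity-invariant : ∀ {i j} → card (Rs i) ≡ 2 → card (Rs j) ≡ 2 → ∀ {x z} → Star Adj x z →
    parity i j x ≡ parity i j z
  parity-invariant card≡2 card≡2′ ε = refl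
  parity-invariant {i} {j} card≡2 card≡2′ {x} {z} (_◅_ {j = y} x∼y y⇝z) = begin
    parity i j x                               ≡⟨ not-xor-not (isZeroAt i x) (isZeroAt j x) ⟨
    not (isZeroAt i x) xor not (isZeroAt j x)  ≡⟨ ≡.cong₂ _xor_ (Adj⇒isZeroAt-flips i card≡2 x∼y)
                                                                (Adj⇒isZeroAt-flips j card≡2′ x∼y) ⟨
    parity i j y                               ≡⟨ parity-invariant card≡2 card≡2′ y⇝z ⟩
    parity i j z                               ∎
    where open ≡.≡-Reasoning

  connected⇒atMostOneF₂ : Connected → AtMostOneF₂
  connected⇒atMostOneF₂ connected i j card≡2 card≡2′ with i ≟ᶠ j
  ... | yes i≡j = i≡j
  ... | no i≢j  = ⊥-elim (false≢true (begin
    false         ≡⟨ ≡.cong₂ _xor_ (isZeroAt-0 i) (isZeroAt-0 j) ⟨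
    parity i j 0# ≡⟨ parity-invariant card≡2 card≡2′ 0⇝c ⟩
    parity i j c  ≡⟨ ≡.cong₂ _xor_ (isZeroAt-cong i) (isZeroAt-cong j) ⟩
    parity i j b  ≡⟨ ≡.cong₂ _xor_ (K.isZero-≉0 i bᵢ≉0) (K.isZero-≈0 j bⱼ≈0) ⟩
    true          ∎))
    where
    open ≡.≡-Reasoning
    false≢true : false ≢ true
    false≢true ()
    isZeroAt-0 : ∀ k → isZeroAt k 0# ≡ true
    isZeroAt-0 k = K.isZero-≈0 k (proj₁ φ-0 k)
    b : Carrier
    b = proj₁ (φ-surj (injK i (K.1# i)))
    φb≈eᵢ : φ b ≈P injK i (K.1# i)
    φb≈eᵢ = proj₂ (φ-surj (injK i (K.1# i)))
    bᵢ≉0 : ¬ K._≈_ i (component i b) (K.0# i)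
    bᵢ≉0 bᵢ≈0 = FiniteField.nontrivial (Rs i)
      (K.trans i (K.sym i (K.trans i (proj₁ φb≈eᵢ i) (K.reflexive i (updateAt-updates 0ᴷ i _)))) bᵢ≈0)
    bⱼ≈0 : K._≈_ j (component j b) (K.0# j)
    bⱼ≈0 = K.trans j (proj₁ φb≈eᵢ j) (K.reflexive j (updateAt-minimal 0ᴷ i _ j i≢j))
    c : Carrier
    c = proj₁ (connected 0# b)
    0⇝c : Star Adj 0# c
    0⇝c = proj₁ (proj₂ (connected 0# b))
    isZeroAt-cong : ∀ k → isZeroAt k c ≡ isZeroAt k b
    isZeroAt-cong k = K.isZero-cong k (proj₁ (φ-resp (proj₂ (proj₂ (connected 0# b)))) k)

mainTheorem7 : (R : Ring 0ℓ 0ℓ) → FiniteRing R →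
    (D : RingDefs.ArtinWedderburn R) →
    RingDefs.Connected R ⇔ RingDefs.ArtinWedderburn.AtMostOneF₂ {R} D
mainTheorem7 R finite D =
  mk⇔ connected⇒atMostOneF₂ (all-SumOfUnits⇒Connected ∘ atMostOneF₂⇒all-SumOfUnits)
  where
  open Theorem R finite D
  open SumsOfUnits R using (all-SumOfUnits⇒Connected)
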